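{- Let $n\ge 4$. For every permutation $\tau\in S_n$ and every maximum-cardinality minimal inversion-complete set $Q\subseteq S_n$, the set $\tau\circ Q=\{\tau\circ\pi:\pi\in Q\}$ is minimally pair-complete.
   Context: $S_n$ is the set of permutations of $[n]$, written as sequences $(\pi(1),\dots,\pi(n))$; $\tau\circ\pi$ is the map $k\mapsto\tau(\pi(k))$. $\pi$ covers the ordered pair $(\pi(k),\pi(l))$ iff $k<l$. An inversion is a pair $(j,i)$ with $1\le i<j\le n$. $Q\subseteq S_n$ is inversion-complete if every inversion is covered by some element of $Q$, and minimally inversion-complete if no proper subset is inversion-complete. $P\subseteq S_n$ is pair-complete if every ordered pair $(i,j)$ of distinct elements of $[n]$ is covered by some element of $P$, and minimally pair-complete if no proper subset of $P$ is pair-complete. -}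

module Defs where

open import Data.Nat using (ℕ; _≤_)
open import Data.Fin as Fin using (Fin)
open import Data.Vec using (Vec; lookup; map)
open import Data.List as List using (List; length)
open import Data.List.Membership.Propositional using (_∈_; _∉_)
open import Data.List.Relation.Unary.All using (All)
open import Data.List.Relation.Unary.Unique.Propositional using (Unique)
open import Data.Product using (Σ; ∃; ∃-syntax; _×_; _,_)
open import Relation.Binary.PropositionalEquality using (_≡_; _≢_)
open import Relation.Nullary using (¬_)

-- A permutation of [n] written as the sequence (π(1),…,π(n)), i.e. a vector
-- of length n with pairwise distinct entries (positions/values use Fin n = {0..n-1}).
IsPerm : {n : ℕ} → Vec (Fin n) n → Set
IsPerm {n} v = ∀ (k l : Fin n) → lookup v k ≡ lookup v l → k ≡ l

_∘ₚ_ : {n : ℕ} → Vec (Fin n) n → Vec (Fin n) n → Vec (Fin n) n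
τ ∘ₚ π = map (lookup τ) π

_∘ₛ_ : {n : ℕ} → Vec (Fin n) n → List (Vec (Fin n) n) → List (Vec (Fin n) n)
τ ∘ₛ Q = List.map (τ ∘ₚ_) Q

Covers : {n : ℕ} → Vec (Fin n) n → Fin n → Fin n → Set
Covers {n} π a b = ∃[ k ] ∃[ l ] (k Fin.< l × lookup π k ≡ a × lookup π l ≡ b)

-- Finite sets of permutations are represented by lists (read as sets: membership
-- is all that matters for completeness / subsets; duplicate-freeness is imposed
-- where cardinality matters).
_⊆_ : {n : ℕ} → List (Vec (Fin n) n) → List (Vec (Fin n) n) → Set
P ⊆ Q = ∀ {x} → x ∈ P → x ∈ Q

_⊂_ : {n : ℕ} → List (Vec (Fin n) n) → List (Vec (Fin n) n) → Set
P ⊂ Q = P ⊆ Q × ∃[ x ] (x ∈ Q × x ∉ P)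

InversionComplete : {n : ℕ} → List (Vec (Fin n) n) → Set
InversionComplete {n} Q = ∀ (i j : Fin n) → i Fin.< j → ∃[ π ] (π ∈ Q × Covers π j i)

MinInversionComplete : {n : ℕ} → List (Vec (Fin n) n) → Set
MinInversionComplete Q =
  InversionComplete Q × (∀ Q' → Q' ⊂ Q → ¬ InversionComplete Q')

PairComplete : {n : ℕ} → List (Vec (Fin n) n) → Set
PairComplete {n} P = ∀ (i j : Fin n) → i ≢ j → ∃[ π ] (π ∈ P × Covers π i j)

MinPairComplete : {n : ℕ} → List (Vec (Fin n) n) → Set
MinPairComplete P =
  PairComplete P × (∀ P' → P' ⊂ P → ¬ PairComplete P')

IsPermSet : {n : ℕ} → List (Vec (Fin n) n) → Set
IsPermSet Q = All IsPerm Q × Unique Q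

MaxMinInversionComplete : {n : ℕ} → List (Vec (Fin n) n) → Set
MaxMinInversionComplete {n} Q =
  IsPermSet Q × MinInversionComplete Q ×
  (∀ (Q' : List (Vec (Fin n) n)) → IsPermSet Q' → MinInversionComplete Q' →
     length Q' ≤ length Q)

-- Composing with a permutation τ merely relabels values, so τ ∘ Q is minimally
-- pair-complete as soon as Q is minimally inversion-complete and pair-complete; the
-- maximality of Q is needed only for pair-completeness. By minimality every member of Q is
-- the only member covering some inversion. Choosing one such inversion per member gives a
-- triangle-free graph on [n] (a permutation covering the inversion (k , i), i < j < k, also
-- covers (k , j) or (j , i)), hence |Q| ≤ ⌊n²/4⌋ by Mantel's argument. Conversely, for
-- l < ⌊n/2⌋ ≤ h the permutations listing the low values except l, then h, l, then the high
-- values except h form a minimal inversion-complete set of exactly that size. If no member of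
-- a maximum Q covered a pair (a , b) with a < b, every member would reverse a and b; then the
-- members whose private inversion has an end at a or b are labelled injectively by its other
-- end, and with Mantel on [n] ∖ {a , b} this gives |Q| ≤ ⌊(n-2)²/4⌋ + n - 2 < ⌊n²/4⌋.

module Submission where

open import Defs
open import Data.Nat as ℕ using (ℕ; zero; suc; _+_; _*_; _≤_; _<_; z≤n; s≤s; z<s; ⌊_/2⌋; ⌈_/2⌉)
import Data.Nat.Properties as ℕ
open import Data.Nat.Induction using (<-wellFounded)
open import Data.Nat.Tactic.RingSolver using (solve-∀)
open import Induction.WellFounded using (Acc; acc)
open import Data.Fin as Fin using (Fin; zero; suc; toℕ; fromℕ; _↑ˡ_; _↑ʳ_; splitAt; punchOut)
import Data.Fin.Properties as Fin
open import Data.Fin.Permutation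
  using (Permutation′; _⟨$⟩ʳ_; _⟨$⟩ˡ_; inverseˡ; inverseʳ; transpose) renaming (_∘ₚ_ to _⨾_)
open import Data.Vec using (Vec; lookup; tabulate)
import Data.Vec.Properties as Vec
open import Data.List using (List; []; _∷_; length; map; _++_; filter; allFin; cartesianProduct)
open import Data.List.Properties using (length-++; length-map; length-tabulate; length-removeAt′)
open import Data.List.Membership.Propositional using (_∈_; find; lose)
open import Data.List.Membership.Propositional.Properties
  using (∈-filter⁺; ∈-filter⁻; ∈-map⁺; ∈-map⁻; ∈-++⁺ˡ; ∈-++⁺ʳ; ∈-allFin;
         ∈-cartesianProduct⁺)
open import Data.List.Relation.Unary.Any as Any using (Any; here; there; _─_)
open import Data.List.Relation.Unary.All as All using (All; _∷_)
import Data.List.Relation.Unary.All.Properties as All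
open import Data.List.Relation.Unary.AllPairs using (_∷_)
open import Data.List.Relation.Unary.Unique.Propositional using (Unique)
import Data.List.Relation.Unary.Unique.Propositional.Properties as Unique
open import Data.Product using (∃₂; ∃-syntax; _×_; _,_; proj₁; proj₂; uncurry)
open import Data.Sum as Sum using (_⊎_; inj₁; inj₂; swap)
open import Data.Empty using (⊥-elim)
open import Function using (id; _∘_)
open import Relation.Binary using (DecidableEquality; tri<; tri≈; tri>)
open import Relation.Nullary using (¬_; Dec; yes; no)
open import Relation.Nullary.Decidable using (_×-dec_; _⊎-dec_; _→-dec_; ¬?; dec-true; dec-false)
open import Relation.Binary.PropositionalEquality
  using (_≡_; _≢_; refl; sym; trans; cong; cong₂; subst; subst₂; module ≡-Reasoning)

∈-─⁺ : ∀ {a} {A : Set a} {x z : A} {ys} (x∈ys : x ∈ ys) → z ∈ ys → z ≢ x →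
       z ∈ (ys ─ x∈ys)
∈-─⁺ (here refl) (here refl) z≢x = ⊥-elim (z≢x refl)
∈-─⁺ (here refl) (there z∈ys) _ = z∈ys
∈-─⁺ (there x∈ys) (here refl) _ = here refl
∈-─⁺ (there x∈ys) (there z∈ys) z≢x = there (∈-─⁺ x∈ys z∈ys z≢x)

module _ {a b r} {A : Set a} {B : Set b} (R : A → B → Set r) where

  length-≤-by-injection : ∀ (xs : List A) (ys : List B) → Unique xs →
    (∀ {x} → x ∈ xs → ∃[ y ] (y ∈ ys × R x y)) →
    (∀ {x x′ y} → x ∈ xs → x′ ∈ xs → R x y → R x′ y → x ≡ x′) →
    length xs ≤ length ys
  length-≤-by-injection [] ys _ _ _ = z≤n
  length-≤-by-injection (x ∷ xs) ys (x∉xs ∷ xs!) related injective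
    with y , y∈ys , Rxy ← related (here refl) =
    subst (suc (length xs) ≤_) (sym (length-removeAt′ ys (Any.index y∈ys)))
      (s≤s (length-≤-by-injection xs (ys ─ y∈ys) xs! related′
             (λ x∈ x′∈ → injective (there x∈) (there x′∈))))
    where
      related′ : ∀ {x′} → x′ ∈ xs → ∃[ y′ ] (y′ ∈ (ys ─ y∈ys) × R x′ y′)
      related′ x′∈xs with y′ , y′∈ys , Rx′y′ ← related (there x′∈xs) =
        y′ , ∈-─⁺ y∈ys y′∈ys (λ { refl → All.lookup x∉xs x′∈xs
                                    (injective (here refl) (there x′∈xs) Rxy Rx′y′) }) , Rx′y′

length-≤-by-⊆ : ∀ {a} {A : Set a} (xs ys : List A) → Unique xs →
                (∀ {x} → x ∈ xs → x ∈ ys) → length xs ≤ length ys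
length-≤-by-⊆ xs ys xs! xs⊆ys =
  length-≤-by-injection _≡_ xs ys xs! (λ x∈ → _ , xs⊆ys x∈ , refl)
    (λ _ _ e e′ → trans e (sym e′))

length-cartesianProduct : ∀ {a b} {A : Set a} {B : Set b} (xs : List A) (ys : List B) →
                          length (cartesianProduct xs ys) ≡ length xs * length ys
length-cartesianProduct [] ys = refl
length-cartesianProduct (x ∷ xs) ys =
  trans (length-++ (map (x ,_) ys))
        (cong₂ _+_ (length-map (x ,_) ys) (length-cartesianProduct xs ys))

-- Covering pairs by permutations

lookup-surjective : ∀ {n} (π : Vec (Fin n) n) → IsPerm π → ∀ y → ∃[ k ] lookup π k ≡ y
lookup-surjective {suc n} π π-perm y with Fin.any? (λ k → lookup π k Fin.≟ y)
... | yes hit = hit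
... | no miss = ⊥-elim (ℕ.1+n≰n (Fin.injective⇒≤ squeezed-injective))
  where
    misses : ∀ k → y ≢ lookup π k
    misses k e = miss (k , sym e)
    squeezed-injective : ∀ {k l} → punchOut (misses k) ≡ punchOut (misses l) → k ≡ l
    squeezed-injective e = π-perm _ _ (Fin.punchOut-injective (misses _) (misses _) e)

module _ {n : ℕ} where

  _≟ᵥ_ : DecidableEquality (Vec (Fin n) n)
  _≟ᵥ_ = Vec.≡-dec Fin._≟_

  delete : Vec (Fin n) n → List (Vec (Fin n) n) → List (Vec (Fin n) n)
  delete π = filter (λ ρ → ¬? (ρ ≟ᵥ π))

  ∈-delete⁺ : ∀ {π σ Q} → σ ∈ Q → σ ≢ π → σ ∈ delete π Q
  ∈-delete⁺ {π} {Q = Q} = ∈-filter⁺ (λ ρ → ¬? (ρ ≟ᵥ π)) {xs = Q}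

  delete-⊂ : ∀ {π Q} → π ∈ Q → delete π Q ⊂ Q
  delete-⊂ {π} {Q} π∈Q =
    (λ σ∈ → proj₁ (∈-filter⁻ (λ ρ → ¬? (ρ ≟ᵥ π)) {xs = Q} σ∈)) ,
    π , π∈Q , (λ π∈ → proj₂ (∈-filter⁻ (λ ρ → ¬? (ρ ≟ᵥ π)) {xs = Q} π∈) refl)

  Covers? : ∀ (π : Vec (Fin n) n) a b → Dec (Covers π a b)
  Covers? π a b = Fin.any? λ k → Fin.any? λ l →
    k Fin.<? l ×-dec lookup π k Fin.≟ a ×-dec lookup π l Fin.≟ b

  uncovered-inversion : ∀ (Q : List (Vec (Fin n) n)) → ¬ InversionComplete Q →
                        ∃₂ λ i j → i Fin.< j × ¬ Any (λ π → Covers π j i) Q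
  uncovered-inversion Q incomplete = search
    where
      covered? : ∀ i j → Dec (Any (λ π → Covers π j i) Q)
      covered? i j = Any.any? (λ π → Covers? π j i) Q

      covered-after? : ∀ i j → Dec (i Fin.< j → Any (λ π → Covers π j i) Q)
      covered-after? i j = i Fin.<? j →-dec covered? i j

      some-uncovered : ¬ (∀ i j → i Fin.< j → Any (λ π → Covers π j i) Q)
      some-uncovered all = incomplete λ i j i<j → find (all i j i<j)

      search : ∃₂ λ i j → i Fin.< j × ¬ Any (λ π → Covers π j i) Q
      search
        with i , ¬all-j ← Fin.¬∀⟶∃¬ n _ (λ i → Fin.all? (covered-after? i)) some-uncovered
        with j , ¬covered ← Fin.¬∀⟶∃¬ n _ (covered-after? i) ¬all-j
        with i Fin.<? j
      ... | yes i<j = i , j , i<j , λ c → ¬covered λ _ → c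
      ... | no i≮j = ⊥-elim (¬covered (⊥-elim ∘ i≮j))

  module _ (π : Vec (Fin n) n) (π-perm : IsPerm π) where

    covers-total : ∀ {a b} → a ≢ b → Covers π a b ⊎ Covers π b a
    covers-total {a} {b} a≢b
      with ka , ka↦a ← lookup-surjective π π-perm a | kb , kb↦b ← lookup-surjective π π-perm b
      with Fin.<-cmp ka kb
    ... | tri< ka<kb _ _ = inj₁ (ka , kb , ka<kb , ka↦a , kb↦b)
    ... | tri≈ _ refl _ = ⊥-elim (a≢b (trans (sym ka↦a) kb↦b))
    ... | tri> _ _ kb<ka = inj₂ (kb , ka , kb<ka , kb↦b , ka↦a)

    covers-trans : ∀ {a b c} → Covers π a b → Covers π b c → Covers π a c
    covers-trans (k , l , k<l , k↦a , l↦b) (l′ , m , l′<m , l′↦b , m↦c)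
      with refl ← π-perm l l′ (trans l↦b (sym l′↦b)) =
      k , m , Fin.<-trans k<l l′<m , k↦a , m↦c

    covers-split : ∀ {a b c} → Covers π a c → b ≢ a → b ≢ c → Covers π a b ⊎ Covers π b c
    covers-split {b = b} (ka , kc , ka<kc , ka↦a , kc↦c) b≢a b≢c
      with kb , kb↦b ← lookup-surjective π π-perm b
      with Fin.<-cmp ka kb
    ... | tri< ka<kb _ _ = inj₁ (ka , kb , ka<kb , ka↦a , kb↦b)
    ... | tri≈ _ refl _ = ⊥-elim (b≢a (trans (sym kb↦b) ka↦a))
    ... | tri> _ _ kb<ka = inj₂ (kb , kc , Fin.<-trans kb<ka ka<kc , kb↦b , kc↦c)

module _ {n : ℕ} (τ σ : Vec (Fin n) n) where

  ∘ₚ-covers⁺ : ∀ {a b} → Covers σ a b → Covers (τ ∘ₚ σ) (lookup τ a) (lookup τ b)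
  ∘ₚ-covers⁺ (k , l , k<l , k↦a , l↦b) =
    k , l , k<l , trans (Vec.lookup-map k (lookup τ) σ) (cong (lookup τ) k↦a)
              , trans (Vec.lookup-map l (lookup τ) σ) (cong (lookup τ) l↦b)

  ∘ₚ-covers⁻ : IsPerm τ → ∀ {a b} → Covers (τ ∘ₚ σ) (lookup τ a) (lookup τ b) → Covers σ a b
  ∘ₚ-covers⁻ τ-perm (k , l , k<l , k↦τa , l↦τb) =
    k , l , k<l , τ-perm _ _ (trans (sym (Vec.lookup-map k (lookup τ) σ)) k↦τa)
              , τ-perm _ _ (trans (sym (Vec.lookup-map l (lookup τ) σ)) l↦τb)

module _ {n : ℕ} (τ : Vec (Fin n) n) (τ-perm : IsPerm τ) {Q : List (Vec (Fin n) n)} where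

  ∘ₛ-pairComplete : PairComplete Q → PairComplete (τ ∘ₛ Q)
  ∘ₛ-pairComplete Q-complete i j i≢j
    with a , a↦i ← lookup-surjective τ τ-perm i | b , b↦j ← lookup-surjective τ τ-perm j
    with σ , σ∈Q , σ-covers ← Q-complete a b (λ { refl → i≢j (trans (sym a↦i) b↦j) }) =
    τ ∘ₚ σ , ∈-map⁺ (τ ∘ₚ_) σ∈Q ,
    subst₂ (Covers (τ ∘ₚ σ)) a↦i b↦j (∘ₚ-covers⁺ τ σ σ-covers)

  ∘ₛ-minimal : MinInversionComplete Q → ∀ P′ → P′ ⊂ (τ ∘ₛ Q) → ¬ PairComplete P′
  ∘ₛ-minimal (_ , Q-minimal) P′ (P′⊆ , τπ , τπ∈ , τπ∉P′) P′-complete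
    with π , π∈Q , refl ← ∈-map⁻ (τ ∘ₚ_) τπ∈ =
    Q-minimal (delete π Q) (delete-⊂ π∈Q) delete-complete
    where
      delete-complete : InversionComplete (delete π Q)
      delete-complete i j i<j
        with ρ , ρ∈P′ , ρ-covers ← P′-complete (lookup τ j) (lookup τ i)
                                     (λ e → Fin.<-irrefl (sym (τ-perm j i e)) i<j)
        with σ , σ∈Q , refl ← ∈-map⁻ (τ ∘ₚ_) (P′⊆ ρ∈P′) =
        σ , ∈-delete⁺ σ∈Q (λ { refl → τπ∉P′ ρ∈P′ }) , ∘ₚ-covers⁻ τ σ τ-perm ρ-covers

-- Mantel's bound for private inversions

quarterSquare : ℕ → ℕ
quarterSquare n = ⌊ n /2⌋ * ⌈ n /2⌉

quarterSquare-+2 : ∀ m → quarterSquare (2 + m) ≡ quarterSquare m + suc m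
quarterSquare-+2 m =
  trans (expand ⌊ m /2⌋ ⌈ m /2⌉) (cong (λ k → quarterSquare m + suc k) (ℕ.⌊n/2⌋+⌈n/2⌉≡n m))
  where
    expand : ∀ a b → suc a * suc b ≡ a * b + suc (a + b)
    expand = solve-∀

quarterSquare-mono : ∀ {m n} → m ≤ n → quarterSquare m ≤ quarterSquare n
quarterSquare-mono m≤n = ℕ.*-mono-≤ (ℕ.⌊n/2⌋-mono m≤n) (ℕ.⌈n/2⌉-mono m≤n)

module _ {n : ℕ} where

  without : Fin n → Fin n → List (Fin n) → List (Fin n)
  without x y = filter (λ u → ¬? (u Fin.≟ x) ×-dec ¬? (u Fin.≟ y))

  ∈-without⁺ : ∀ {x y u S} → u ∈ S → u ≢ x → u ≢ y → u ∈ without x y S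
  ∈-without⁺ {x} {y} {S = S} u∈S u≢x u≢y =
    ∈-filter⁺ (λ u → ¬? (u Fin.≟ x) ×-dec ¬? (u Fin.≟ y)) {xs = S} u∈S (u≢x , u≢y)

  ∈-without⁻ : ∀ {x y u S} → u ∈ without x y S → u ∈ S × u ≢ x × u ≢ y
  ∈-without⁻ {x} {y} {S = S} = ∈-filter⁻ (λ u → ¬? (u Fin.≟ x) ×-dec ¬? (u Fin.≟ y)) {xs = S}

  length-without : ∀ {x y S} → Unique S → x ∈ S → y ∈ S → x ≢ y →
                   2 + length (without x y S) ≤ length S
  length-without {x} {y} {S} S! x∈S y∈S x≢y =
    length-≤-by-⊆ (x ∷ y ∷ without x y S) S
      ((x≢y ∷ All.tabulate (λ u∈ → proj₁ (proj₂ (kept u∈)) ∘ sym))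
        ∷ All.tabulate (λ u∈ → proj₂ (proj₂ (kept u∈)) ∘ sym)
        ∷ Unique.filter⁺ _ S!)
      λ { (here refl) → x∈S ; (there (here refl)) → y∈S ; (there (there u∈)) → proj₁ (kept u∈) }
    where
      kept : ∀ {u} → u ∈ without x y S → u ∈ S × u ≢ x × u ≢ y
      kept = ∈-without⁻ {x} {y} {S = S}

  classify : ∀ x y {u S} → u ∈ S → u ≡ x ⊎ u ≡ y ⊎ u ∈ without x y S
  classify x y {u} u∈S with u Fin.≟ x | u Fin.≟ y
  ... | yes u≡x | _ = inj₁ u≡x
  ... | no _ | yes u≡y = inj₂ (inj₁ u≡y)
  ... | no u≢x | no u≢y = inj₂ (inj₂ (∈-without⁺ u∈S u≢x u≢y))

-- Privately covered inversions, viewed as edges {x , y} of a graph on Fin n.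
module Ownership {n : ℕ} (Q : List (Vec (Fin n) n)) (Q-perm : All IsPerm Q) where

  perm : ∀ {σ} → σ ∈ Q → IsPerm σ
  perm = All.lookup Q-perm

  PrivatelyCovers : Vec (Fin n) n → Fin n → Fin n → Set
  PrivatelyCovers σ j i = σ ∈ Q × Covers σ j i × All (λ ρ → Covers ρ j i → ρ ≡ σ) Q

  Owns : Vec (Fin n) n → Fin n → Fin n → Set
  Owns σ x y = (y Fin.< x × PrivatelyCovers σ x y) ⊎ (x Fin.< y × PrivatelyCovers σ y x)

  privatelyCovers? : ∀ σ j i → Dec (PrivatelyCovers σ j i)
  privatelyCovers? σ j i =
    Any.any? (σ ≟ᵥ_) Q ×-dec Covers? σ j i ×-dec
    All.all? (λ ρ → Covers? ρ j i →-dec ρ ≟ᵥ σ) Q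

  owns? : ∀ σ x y → Dec (Owns σ x y)
  owns? σ x y = (y Fin.<? x ×-dec privatelyCovers? σ x y) ⊎-dec (x Fin.<? y ×-dec privatelyCovers? σ y x)

  owns-sym : ∀ {σ x y} → Owns σ x y → Owns σ y x
  owns-sym (inj₁ o) = inj₂ o
  owns-sym (inj₂ o) = inj₁ o

  owns-irrefl : ∀ {σ x y} → Owns σ x y → x ≢ y
  owns-irrefl (inj₁ (y<x , _)) refl = Fin.<-irrefl refl y<x
  owns-irrefl (inj₂ (x<y , _)) refl = Fin.<-irrefl refl x<y

  private-unique : ∀ {σ σ′ j i} → PrivatelyCovers σ j i → PrivatelyCovers σ′ j i → σ ≡ σ′
  private-unique (_ , _ , only-σ) (σ′∈Q , σ′-covers , _) =
    sym (All.lookup only-σ σ′∈Q σ′-covers)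

  owns-unique : ∀ {σ σ′ x y} → Owns σ x y → Owns σ′ x y → σ ≡ σ′
  owns-unique (inj₁ (_ , o)) (inj₁ (_ , o′)) = private-unique o o′
  owns-unique (inj₂ (_ , o)) (inj₂ (_ , o′)) = private-unique o o′
  owns-unique (inj₁ (y<x , _)) (inj₂ (x<y , _)) = ⊥-elim (Fin.<-asym y<x x<y)
  owns-unique (inj₂ (x<y , _)) (inj₁ (y<x , _)) = ⊥-elim (Fin.<-asym y<x x<y)

  owns⇒private : ∀ {σ i j} → i Fin.< j → Owns σ j i → PrivatelyCovers σ j i
  owns⇒private _ (inj₁ (_ , o)) = o
  owns⇒private i<j (inj₂ (j<i , _)) = ⊥-elim (Fin.<-asym i<j j<i)

  long-edge-owner : ∀ {A B C i j k} → i Fin.< j → j Fin.< k →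
    PrivatelyCovers A k i → PrivatelyCovers B k j → PrivatelyCovers C j i → A ≡ B ⊎ A ≡ C
  long-edge-owner {A} i<j j<k (A∈Q , A-covers , _) (_ , _ , only-B) (_ , _ , only-C)
    with covers-split A (perm A∈Q) A-covers (Fin.<⇒≢ j<k) (Fin.<⇒≢ i<j ∘ sym)
  ... | inj₁ kj = inj₁ (All.lookup only-B A∈Q kj)
  ... | inj₂ ji = inj₂ (All.lookup only-C A∈Q ji)

  Between : Fin n → Fin n → Fin n → Set
  Between x m y = (x Fin.< m × m Fin.< y) ⊎ (y Fin.< m × m Fin.< x)

  between-owner : ∀ {A B C x m y} → Between x m y →
    Owns A x y → Owns B x m → Owns C m y → A ≡ B ⊎ A ≡ C
  between-owner (inj₁ (x<m , m<y)) oA oB oC =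
    swap (long-edge-owner x<m m<y (owns⇒private (Fin.<-trans x<m m<y) (owns-sym oA))
                                  (owns⇒private m<y (owns-sym oC)) (owns⇒private x<m (owns-sym oB)))
  between-owner (inj₂ (y<m , m<x)) oA oB oC =
    long-edge-owner y<m m<x (owns⇒private (Fin.<-trans y<m m<x) oA)
                            (owns⇒private m<x oB) (owns⇒private y<m oC)

  some-between : ∀ {x y c} → x ≢ y → x ≢ c → y ≢ c →
                 Between x c y ⊎ Between y x c ⊎ Between x y c
  some-between {x} {y} {c} x≢y x≢c y≢c with Fin.<-cmp x y | Fin.<-cmp y c | Fin.<-cmp x c
  ... | tri< x<y _ _ | tri< y<c _ _ | _            = inj₂ (inj₂ (inj₁ (x<y , y<c)))
  ... | tri> _ _ y<x | tri> _ _ c<y | _            = inj₂ (inj₂ (inj₂ (c<y , y<x)))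
  ... | tri< _ _ _   | tri> _ _ c<y | tri< x<c _ _ = inj₁ (inj₁ (x<c , c<y))
  ... | tri< x<y _ _ | tri> _ _ _   | tri> _ _ c<x = inj₂ (inj₁ (inj₂ (c<x , x<y)))
  ... | tri> _ _ y<x | tri< _ _ _   | tri< x<c _ _ = inj₂ (inj₁ (inj₁ (y<x , x<c)))
  ... | tri> _ _ _   | tri< y<c _ _ | tri> _ _ c<x = inj₁ (inj₂ (y<c , c<x))
  ... | tri≈ _ x≡y _ | _            | _            = ⊥-elim (x≢y x≡y)
  ... | _            | tri≈ _ y≡c _ | _            = ⊥-elim (y≢c y≡c)
  ... | _            | _            | tri≈ _ x≡c _ = ⊥-elim (x≢c x≡c)

  triangle : ∀ {σ₀ σ σ′ x y c} → Owns σ₀ x y → Owns σ x c → Owns σ′ y c →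
             σ ≢ σ₀ → σ′ ≢ σ₀ → σ ≡ σ′
  triangle o₀ o o′ σ≢σ₀ σ′≢σ₀
    with some-between (owns-irrefl o₀) (owns-irrefl o) (owns-irrefl o′)
  ... | inj₁ c-between with between-owner c-between o₀ o (owns-sym o′)
  ...   | inj₁ σ₀≡σ = ⊥-elim (σ≢σ₀ (sym σ₀≡σ))
  ...   | inj₂ σ₀≡σ′ = ⊥-elim (σ′≢σ₀ (sym σ₀≡σ′))
  triangle o₀ o o′ σ≢σ₀ σ′≢σ₀ | inj₂ (inj₁ x-between)
    with between-owner x-between o′ (owns-sym o₀) o
  ...   | inj₁ σ′≡σ₀ = ⊥-elim (σ′≢σ₀ σ′≡σ₀)
  ...   | inj₂ σ′≡σ = sym σ′≡σ
  triangle o₀ o o′ σ≢σ₀ σ′≢σ₀ | inj₂ (inj₂ y-between)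
    with between-owner y-between o o₀ o′
  ...   | inj₁ σ≡σ₀ = ⊥-elim (σ≢σ₀ σ≡σ₀)
  ...   | inj₂ σ≡σ′ = σ≡σ′

  minimal⇒owns : MinInversionComplete Q → ∀ {σ} → σ ∈ Q → ∃₂ λ x y → Owns σ x y
  minimal⇒owns (Q-complete , Q-minimal) {σ} σ∈Q
    with i , j , i<j , uncovered ← uncovered-inversion (delete σ Q) (Q-minimal _ (delete-⊂ σ∈Q))
    with ρ , ρ∈Q , ρ-covers ← Q-complete i j i<j =
    j , i , inj₁ (i<j , σ∈Q , subst (λ π → Covers π j i) (only-σ ρ∈Q ρ-covers) ρ-covers ,
                  All.tabulate only-σ)
    where
      only-σ : ∀ {ρ} → ρ ∈ Q → Covers ρ j i → ρ ≡ σ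
      only-σ {ρ} ρ∈Q ρ-covers with ρ ≟ᵥ σ
      ... | yes ρ≡σ = ρ≡σ
      ... | no ρ≢σ = ⊥-elim (uncovered (lose (∈-delete⁺ ρ∈Q ρ≢σ) ρ-covers))

  module _ {a b} (a<b : a Fin.< b) (reversed : ∀ {ρ} → ρ ∈ Q → Covers ρ b a) where

    reversed-owner : ∀ {σ} → Owns σ a b → ∀ {ρ} → ρ ∈ Q → ρ ≡ σ
    reversed-owner o ρ∈Q =
      All.lookup (proj₂ (proj₂ (owns⇒private a<b (owns-sym o)))) ρ∈Q (reversed ρ∈Q)

    reversed-pair-owners : ∀ {σ σ′ c} → Owns σ a c → Owns σ′ b c →
                           σ ≡ σ′ ⊎ (∀ {ρ} → ρ ∈ Q → ρ ≡ σ ⊎ ρ ≡ σ′)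
    reversed-pair-owners {σ} {σ′} {c} o o′ with Fin.<-cmp c a
    ... | tri≈ _ c≡a _ = ⊥-elim (owns-irrefl o (sym c≡a))
    ... | tri< c<a _ _
      with σ∈Q , σ-covers , _ ← owns⇒private c<a o
      with _ , _ , only-σ′ ← owns⇒private (Fin.<-trans c<a a<b) o′ =
      inj₁ (All.lookup only-σ′ σ∈Q (covers-trans σ (perm σ∈Q) (reversed σ∈Q) σ-covers))
    ... | tri> _ _ a<c with Fin.<-cmp c b
    ...   | tri≈ _ c≡b _ = ⊥-elim (owns-irrefl o′ (sym c≡b))
    ...   | tri> _ _ b<c
      with _ , _ , only-σ ← owns⇒private a<c (owns-sym o)
      with σ′∈Q , σ′-covers , _ ← owns⇒private b<c (owns-sym o′) =
      inj₁ (sym (All.lookup only-σ σ′∈Q (covers-trans σ′ (perm σ′∈Q) σ′-covers (reversed σ′∈Q))))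
    ...   | tri< c<b _ _
      with _ , _ , only-σ ← owns⇒private a<c (owns-sym o)
      with _ , _ , only-σ′ ← owns⇒private c<b o′ =
      inj₂ λ {ρ} ρ∈Q → swap (Sum.map (All.lookup only-σ′ ρ∈Q) (All.lookup only-σ ρ∈Q)
        (covers-split ρ (perm ρ∈Q) (reversed ρ∈Q) (Fin.<⇒≢ c<b) (Fin.<⇒≢ a<c ∘ sym)))

  OwnsIn : List (Fin n) → Vec (Fin n) n → Set
  OwnsIn S σ = Any (λ x → Any (λ y → Owns σ x y) S) S

  ownsIn? : ∀ S σ → Dec (OwnsIn S σ)
  ownsIn? S σ = Any.any? (λ x → Any.any? (λ y → owns? σ x y) S) S

  ownsIn⁺ : ∀ {S σ x y} → x ∈ S → y ∈ S → Owns σ x y → OwnsIn S σ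
  ownsIn⁺ x∈S y∈S o = lose x∈S (lose y∈S o)

  ownsIn⁻ : ∀ {S σ} → OwnsIn S σ → ∃₂ λ x y → x ∈ S × y ∈ S × Owns σ x y
  ownsIn⁻ inside with x , x∈S , inside′ ← find inside with y , y∈S , o ← find inside′ =
    x , y , x∈S , y∈S , o

  edge-leaving : ∀ {σ x y u v S} → u ∈ S → v ∈ S → Owns σ u v → ¬ OwnsIn (without x y S) σ →
                 Owns σ x y ⊎ ∃[ c ] (c ∈ without x y S × (Owns σ x c ⊎ Owns σ y c))
  edge-leaving {x = x} {y} u∈S v∈S o outside with classify x y u∈S | classify x y v∈S
  ... | inj₂ (inj₂ u∈) | inj₂ (inj₂ v∈) = ⊥-elim (outside (ownsIn⁺ u∈ v∈ o))
  ... | inj₁ refl        | inj₂ (inj₂ v∈) = inj₂ (_ , v∈ , inj₁ o)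
  ... | inj₂ (inj₁ refl) | inj₂ (inj₂ v∈) = inj₂ (_ , v∈ , inj₂ o)
  ... | inj₂ (inj₂ u∈) | inj₁ refl        = inj₂ (_ , u∈ , inj₁ (owns-sym o))
  ... | inj₂ (inj₂ u∈) | inj₂ (inj₁ refl) = inj₂ (_ , u∈ , inj₂ (owns-sym o))
  ... | inj₁ refl        | inj₂ (inj₁ refl) = inj₁ o
  ... | inj₂ (inj₁ refl) | inj₁ refl        = inj₁ (owns-sym o)
  ... | inj₁ refl        | inj₁ refl        = ⊥-elim (owns-irrefl o refl)
  ... | inj₂ (inj₁ refl) | inj₂ (inj₁ refl) = ⊥-elim (owns-irrefl o refl)

  fan-bound : ∀ {x y} (G : List (Vec (Fin n) n)) (S : List (Fin n)) → Unique G →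
    (∀ {σ} → σ ∈ G → ∃[ c ] (c ∈ S × (Owns σ x c ⊎ Owns σ y c))) →
    (∀ {σ σ′ c} → σ ∈ G → σ′ ∈ G → Owns σ x c → Owns σ′ y c → σ ≡ σ′) →
    length G ≤ length S
  fan-bound {x} {y} G S G! fan cross =
    length-≤-by-injection (λ σ c → Owns σ x c ⊎ Owns σ y c) G S G! fan injective
    where
      injective : ∀ {σ σ′ c} → σ ∈ G → σ′ ∈ G →
                  Owns σ x c ⊎ Owns σ y c → Owns σ′ x c ⊎ Owns σ′ y c → σ ≡ σ′
      injective _ _ (inj₁ o) (inj₁ o′) = owns-unique o o′
      injective _ _ (inj₂ o) (inj₂ o′) = owns-unique o o′
      injective σ∈G σ′∈G (inj₁ o) (inj₂ o′) = cross σ∈G σ′∈G o o′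
      injective σ∈G σ′∈G (inj₂ o) (inj₁ o′) = sym (cross σ′∈G σ∈G o′ o)

module Counting {n : ℕ} (Q : List (Vec (Fin n) n)) (Q-perm : All IsPerm Q) (Q-unique : Unique Q) where

  open Ownership Q Q-perm

  ownersIn : List (Fin n) → List (Vec (Fin n) n)
  ownersIn S = filter (ownsIn? S) Q

  ownersIn⁻ : ∀ {S σ} → σ ∈ ownersIn S → σ ∈ Q × OwnsIn S σ
  ownersIn⁻ {S} = ∈-filter⁻ (ownsIn? S) {xs = Q}

  ownersIn-unique : ∀ S → Unique (ownersIn S)
  ownersIn-unique S = Unique.filter⁺ (ownsIn? S) Q-unique

  -- Removing the endpoints of an edge owned by σ₀ loses σ₀ and, by the triangle lemma,
  -- at most one owner per remaining point.
  ownersIn-without : ∀ {S σ₀ x y} → σ₀ ∈ Q → x ∈ S → y ∈ S → Owns σ₀ x y →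
    length (ownersIn S) ≤ length (ownersIn (without x y S)) + suc (length (without x y S))
  ownersIn-without {S} {σ₀} {x} {y} σ₀∈Q x∈S y∈S o₀ = begin
    length (ownersIn S)                   ≤⟨ length-≤-by-⊆ (ownersIn S) _ (ownersIn-unique S) split ⟩
    length (ownersIn S′ ++ σ₀ ∷ G)        ≡⟨ length-++ (ownersIn S′) ⟩
    length (ownersIn S′) + suc (length G) ≤⟨ ℕ.+-monoʳ-≤ (length (ownersIn S′)) (s≤s G-bound) ⟩
    length (ownersIn S′) + suc (length S′) ∎
    where
      open ℕ.≤-Reasoning
      S′ : List (Fin n)
      S′ = without x y S

      new? : ∀ σ → Dec (¬ OwnsIn S′ σ × σ ≢ σ₀)
      new? σ = ¬? (ownsIn? S′ σ) ×-dec ¬? (σ ≟ᵥ σ₀)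

      G : List (Vec (Fin n) n)
      G = filter new? (ownersIn S)

      split : ∀ {σ} → σ ∈ ownersIn S → σ ∈ ownersIn S′ ++ σ₀ ∷ G
      split {σ} σ∈ with ownsIn? S′ σ | σ ≟ᵥ σ₀
      ... | yes inside | _ =
        ∈-++⁺ˡ (∈-filter⁺ (ownsIn? S′) {xs = Q} (proj₁ (ownersIn⁻ σ∈)) inside)
      ... | no _ | yes refl = ∈-++⁺ʳ (ownersIn S′) (here refl)
      ... | no outside | no σ≢σ₀ =
        ∈-++⁺ʳ (ownersIn S′) (there (∈-filter⁺ new? {xs = ownersIn S} σ∈ (outside , σ≢σ₀)))

      G⁻ : ∀ {σ} → σ ∈ G → σ ∈ ownersIn S × ¬ OwnsIn S′ σ × σ ≢ σ₀
      G⁻ = ∈-filter⁻ new? {xs = ownersIn S}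

      fan : ∀ {σ} → σ ∈ G → ∃[ c ] (c ∈ S′ × (Owns σ x c ⊎ Owns σ y c))
      fan σ∈G with σ∈ , outside , σ≢σ₀ ← G⁻ σ∈G
                 with u , v , u∈S , v∈S , o ← ownsIn⁻ (proj₂ (ownersIn⁻ σ∈))
                 with edge-leaving u∈S v∈S o outside
      ... | inj₁ o′ = ⊥-elim (σ≢σ₀ (owns-unique o′ o₀))
      ... | inj₂ leaving = leaving

      G-bound : length G ≤ length S′
      G-bound = fan-bound G S′ (Unique.filter⁺ new? (ownersIn-unique S)) fan
        λ σ∈G σ′∈G o o′ → triangle o₀ o o′ (proj₂ (proj₂ (G⁻ σ∈G))) (proj₂ (proj₂ (G⁻ σ′∈G)))

  mantel-bound : ∀ S → Unique S → length (ownersIn S) ≤ quarterSquare (length S)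
  mantel-bound S S! = bound S S! (<-wellFounded (length S))
    where
      bound : ∀ S → Unique S → Acc _<_ (length S) → length (ownersIn S) ≤ quarterSquare (length S)
      bound S S! (acc smaller) with Any.any? (ownsIn? S) Q
      ... | no none = ℕ.≤-trans (length-≤-by-⊆ (ownersIn S) [] (ownersIn-unique S) nothing) z≤n
        where
          nothing : ∀ {σ} → σ ∈ ownersIn S → σ ∈ []
          nothing σ∈ = ⊥-elim (none (lose (proj₁ (ownersIn⁻ σ∈)) (proj₂ (ownersIn⁻ σ∈))))
      ... | yes some
        with σ₀ , σ₀∈Q , inside ← find some
        with x , y , x∈S , y∈S , o₀ ← ownsIn⁻ inside = begin
          length (ownersIn S)                 ≤⟨ ownersIn-without σ₀∈Q x∈S y∈S o₀ ⟩
          length (ownersIn S′) + suc s′       ≤⟨ ℕ.+-monoˡ-≤ (suc s′) S′-bound ⟩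
          quarterSquare s′ + suc s′           ≡⟨ quarterSquare-+2 s′ ⟨
          quarterSquare (2 + s′)              ≤⟨ quarterSquare-mono S′-length ⟩
          quarterSquare (length S)            ∎
        where
          open ℕ.≤-Reasoning
          S′ = without x y S
          s′ = length S′
          S′-length : 2 + s′ ≤ length S
          S′-length = length-without S! x∈S y∈S (owns-irrefl o₀)
          S′-bound : length (ownersIn S′) ≤ quarterSquare s′
          S′-bound = bound S′ (Unique.filter⁺ _ S!)
                           (smaller (ℕ.≤-trans (ℕ.n≤1+n (suc s′)) S′-length))

  at-most-two : ∀ {σ σ′} → (∀ {ρ} → ρ ∈ Q → ρ ≡ σ ⊎ ρ ≡ σ′) → length Q ≤ 2
  at-most-two {σ} {σ′} among = length-≤-by-⊆ Q (σ ∷ σ′ ∷ []) Q-unique (case ∘ among)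
    where
      case : ∀ {ρ} → ρ ≡ σ ⊎ ρ ≡ σ′ → ρ ∈ σ ∷ σ′ ∷ []
      case (inj₁ refl) = here refl
      case (inj₂ refl) = there (here refl)

  -- As in ownersIn-without, but no member owns {a , b} (it would be the only member of Q),
  -- which saves the one extra owner and makes the bound strict.
  reversed-pair-bound : MinInversionComplete Q → 2 < length Q → ∀ {a b} → a Fin.< b →
                        (∀ {ρ} → ρ ∈ Q → Covers ρ b a) → length Q < quarterSquare n
  reversed-pair-bound Q-minIC 2<|Q| {a} {b} a<b reversed = begin-strict
    length Q                           ≤⟨ length-≤-by-⊆ Q (ownersIn S′ ++ G) Q-unique split ⟩
    length (ownersIn S′ ++ G)          ≡⟨ length-++ (ownersIn S′) ⟩
    length (ownersIn S′) + length G    ≤⟨ ℕ.+-mono-≤ (mantel-bound S′ S′-unique) G-bound ⟩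
    quarterSquare s′ + s′              <⟨ ℕ.+-monoʳ-< (quarterSquare s′) (ℕ.n<1+n s′) ⟩
    quarterSquare s′ + suc s′          ≡⟨ quarterSquare-+2 s′ ⟨
    quarterSquare (2 + s′)             ≤⟨ quarterSquare-mono S′-length ⟩
    quarterSquare n                    ∎
    where
      open ℕ.≤-Reasoning
      S′ = without a b (allFin n)
      s′ = length S′

      S′-unique : Unique S′
      S′-unique = Unique.filter⁺ _ (Unique.allFin⁺ n)

      S′-length : 2 + s′ ≤ n
      S′-length = subst (2 + s′ ≤_) (length-tabulate {n = n} (λ i → i))
        (length-without (Unique.allFin⁺ n) (∈-allFin a) (∈-allFin b) (Fin.<⇒≢ a<b))

      outside? : ∀ σ → Dec (¬ OwnsIn S′ σ)
      outside? σ = ¬? (ownsIn? S′ σ)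

      G : List (Vec (Fin n) n)
      G = filter outside? Q

      split : ∀ {σ} → σ ∈ Q → σ ∈ ownersIn S′ ++ G
      split {σ} σ∈Q with ownsIn? S′ σ
      ... | yes inside = ∈-++⁺ˡ (∈-filter⁺ (ownsIn? S′) {xs = Q} σ∈Q inside)
      ... | no outside = ∈-++⁺ʳ (ownersIn S′) (∈-filter⁺ outside? {xs = Q} σ∈Q outside)

      fan : ∀ {σ} → σ ∈ G → ∃[ c ] (c ∈ S′ × (Owns σ a c ⊎ Owns σ b c))
      fan {σ} σ∈G =
        let σ∈Q , outside = ∈-filter⁻ outside? {xs = Q} σ∈G
            u , v , o = minimal⇒owns Q-minIC σ∈Q
            owns-ab⇒small o-ab = at-most-two {σ} {σ} (inj₁ ∘ reversed-owner a<b reversed o-ab)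
        in Sum.[ ⊥-elim ∘ ℕ.<⇒≱ 2<|Q| ∘ owns-ab⇒small , id ]
             (edge-leaving (∈-allFin u) (∈-allFin v) o outside)

      cross : ∀ {σ σ′ c} → σ ∈ G → σ′ ∈ G → Owns σ a c → Owns σ′ b c → σ ≡ σ′
      cross _ _ o o′ with reversed-pair-owners a<b reversed o o′
      ... | inj₁ σ≡σ′ = σ≡σ′
      ... | inj₂ among = ⊥-elim (ℕ.<⇒≱ 2<|Q| (at-most-two among))

      G-bound : length G ≤ s′
      G-bound = fan-bound G S′ (Unique.filter⁺ outside? Q-unique) fan cross

-- Minimal inversion-complete sets of size ⌊n²/4⌋

-- ρ sends each value to its rank; byRank ρ lists the values by increasing rank.
module _ {n : ℕ} (ρ : Permutation′ n) where

  byRank : Vec (Fin n) n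
  byRank = tabulate (ρ ⟨$⟩ˡ_)

  lookup-byRank : ∀ k → lookup byRank k ≡ ρ ⟨$⟩ˡ k
  lookup-byRank = Vec.lookup∘tabulate (ρ ⟨$⟩ˡ_)

  byRank-isPerm : IsPerm byRank
  byRank-isPerm k l e = begin
    k                  ≡⟨ inverseʳ ρ ⟨
    ρ ⟨$⟩ʳ (ρ ⟨$⟩ˡ k)  ≡⟨ cong (ρ ⟨$⟩ʳ_) (trans (sym (lookup-byRank k)) (trans e (lookup-byRank l))) ⟩
    ρ ⟨$⟩ʳ (ρ ⟨$⟩ˡ l)  ≡⟨ inverseʳ ρ ⟩
    l                  ∎
    where open ≡-Reasoning

  byRank-covers⁺ : ∀ {a b} → ρ ⟨$⟩ʳ a Fin.< ρ ⟨$⟩ʳ b → Covers byRank a b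
  byRank-covers⁺ {a} {b} lt = _ , _ , lt , lists a , lists b
    where
      lists : ∀ a → lookup byRank (ρ ⟨$⟩ʳ a) ≡ a
      lists a = trans (lookup-byRank (ρ ⟨$⟩ʳ a)) (inverseˡ ρ)

  byRank-covers⁻ : ∀ {a b} → Covers byRank a b → ρ ⟨$⟩ʳ a Fin.< ρ ⟨$⟩ʳ b
  byRank-covers⁻ (k , l , k<l , k↦a , l↦b) = subst₂ Fin._<_ (rank-of k↦a) (rank-of l↦b) k<l
    where
      rank-of : ∀ {k a} → lookup byRank k ≡ a → k ≡ ρ ⟨$⟩ʳ a
      rank-of {k} refl = trans (sym (inverseʳ ρ)) (cong (ρ ⟨$⟩ʳ_) (sym (lookup-byRank k)))

module _ {n : ℕ} (i j : Fin n) where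

  transpose-at₁ : transpose i j ⟨$⟩ʳ i ≡ j
  transpose-at₁ rewrite dec-true (i Fin.≟ i) refl = refl

  transpose-at₂ : transpose i j ⟨$⟩ʳ j ≡ i
  transpose-at₂ with j Fin.≟ i
  ... | yes j≡i = j≡i
  ... | no _ rewrite dec-true (j Fin.≟ j) refl = refl

  transpose-fix : ∀ k → k ≢ i → k ≢ j → transpose i j ⟨$⟩ʳ k ≡ k
  transpose-fix k k≢i k≢j rewrite dec-false (k Fin.≟ i) k≢i | dec-false (k Fin.≟ j) k≢j = refl

module Crossed (p q : ℕ) where

  Point : Set
  Point = Fin (suc p + suc q)

  low : Fin (suc p) → Point
  low i = i ↑ˡ suc q

  high : Fin (suc q) → Point
  high j = suc p ↑ʳ j

  data LowOrHigh : Point → Set where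
    isLow  : ∀ i → LowOrHigh (low i)
    isHigh : ∀ j → LowOrHigh (high j)

  lowOrHigh : ∀ k → LowOrHigh k
  lowOrHigh k with splitAt (suc p) k in eq
  ... | inj₁ i = subst LowOrHigh (Fin.splitAt⁻¹-↑ˡ eq) (isLow i)
  ... | inj₂ j = subst LowOrHigh (Fin.splitAt⁻¹-↑ʳ eq) (isHigh j)

  lastLow firstHigh : Point
  lastLow = low (fromℕ p)
  firstHigh = high zero

  low<high : ∀ i j → low i Fin.< high j
  low<high i j = subst₂ ℕ._<_ (sym (Fin.toℕ-↑ˡ i (suc q))) (sym (Fin.toℕ-↑ʳ (suc p) j))
                   (ℕ.<-≤-trans (Fin.toℕ<n i) (ℕ.m≤m+n (suc p) (toℕ j)))

  low-injective : ∀ {i i′} → low i ≡ low i′ → i ≡ i′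
  low-injective = Fin.↑ˡ-injective (suc q) _ _

  high-injective : ∀ {j j′} → high j ≡ high j′ → j ≡ j′
  high-injective = Fin.↑ʳ-injective (suc p) _ _

  low≢high : ∀ {i j} → low i ≢ high j
  low≢high {i} {j} = Fin.<⇒≢ (low<high i j)

  high≢low : ∀ {i j} → high j ≢ low i
  high≢low = low≢high ∘ sym

  toℕ-low< : ∀ i → i ≢ fromℕ p → toℕ (low i) < p
  toℕ-low< i i≢p = subst (_< p) (sym (Fin.toℕ-↑ˡ i (suc q)))
    (ℕ.≤∧≢⇒< (ℕ.s≤s⁻¹ (Fin.toℕ<n i))
             (λ e → i≢p (Fin.toℕ-injective (trans e (sym (Fin.toℕ-fromℕ p))))))

  toℕ-high> : ∀ j → j ≢ zero → suc p < toℕ (high j)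
  toℕ-high> zero j≢0 = ⊥-elim (j≢0 refl)
  toℕ-high> (suc j) _ = subst (suc p <_) (sym (Fin.toℕ-↑ʳ (suc p) (suc j))) (ℕ.m<m+n (suc p) z<s)

  toℕ-lastLow : toℕ lastLow ≡ p
  toℕ-lastLow = trans (Fin.toℕ-↑ˡ (fromℕ p) (suc q)) (Fin.toℕ-fromℕ p)

  toℕ-firstHigh : toℕ firstHigh ≡ suc p
  toℕ-firstHigh = trans (Fin.toℕ-↑ʳ (suc p) zero) (ℕ.+-identityʳ (suc p))

  module _ (i : Fin (suc p)) (j : Fin (suc q)) where

    private
      swapLow swapHigh swapMiddle : Permutation′ (suc p + suc q)
      swapLow = transpose lastLow (low i)
      swapHigh = transpose firstHigh (high j)
      swapMiddle = transpose lastLow firstHigh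

      afterSwapLow : Point → Point
      afterSwapLow k = swapMiddle ⟨$⟩ʳ (swapHigh ⟨$⟩ʳ k)

    -- The low points other than i get the ranks below p, then come high j and low i,
    -- then the remaining high points.
    rank : Permutation′ (suc p + suc q)
    rank = swapLow ⨾ swapHigh ⨾ swapMiddle

    crossed : Vec Point (suc p + suc q)
    crossed = byRank rank

    private
      rankOf : Point → ℕ
      rankOf k = toℕ (rank ⟨$⟩ʳ k)

      afterSwapLow-fixes : ∀ k → k ≢ fromℕ p → afterSwapLow (low k) ≡ low k
      afterSwapLow-fixes k k≢p =
        trans (cong (swapMiddle ⟨$⟩ʳ_) (transpose-fix firstHigh (high j) (low k) low≢high low≢high))
              (transpose-fix lastLow firstHigh (low k) (k≢p ∘ low-injective) low≢high)

    rankOf-low-pivot : rankOf (low i) ≡ suc p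
    rankOf-low-pivot = trans (cong toℕ moves) toℕ-firstHigh
      where
        moves : rank ⟨$⟩ʳ low i ≡ firstHigh
        moves = trans (cong afterSwapLow (transpose-at₂ lastLow (low i)))
                (trans (cong (swapMiddle ⟨$⟩ʳ_)
                             (transpose-fix firstHigh (high j) lastLow low≢high low≢high))
                       (transpose-at₁ lastLow firstHigh))

    rankOf-high-pivot : rankOf (high j) ≡ p
    rankOf-high-pivot = trans (cong toℕ moves) toℕ-lastLow
      where
        moves : rank ⟨$⟩ʳ high j ≡ lastLow
        moves = trans (cong afterSwapLow (transpose-fix lastLow (low i) (high j) high≢low high≢low))
                (trans (cong (swapMiddle ⟨$⟩ʳ_) (transpose-at₂ firstHigh (high j)))
                       (transpose-at₂ lastLow firstHigh))

    rankOf-low : ∀ {i′} → i′ ≢ i → rankOf (low i′) < p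
    rankOf-low {i′} i′≢i with i′ Fin.≟ fromℕ p
    ... | yes refl = subst (_< p) (cong toℕ (sym moves)) (toℕ-low< i (i′≢i ∘ sym))
      where
        moves : rank ⟨$⟩ʳ lastLow ≡ low i
        moves = trans (cong afterSwapLow (transpose-at₁ lastLow (low i)))
                      (afterSwapLow-fixes i (i′≢i ∘ sym))
    ... | no i′≢p = subst (_< p) (cong toℕ (sym moves)) (toℕ-low< i′ i′≢p)
      where
        moves : rank ⟨$⟩ʳ low i′ ≡ low i′
        moves = trans (cong afterSwapLow (transpose-fix lastLow (low i) (low i′) (i′≢p ∘ low-injective)
                                                            (i′≢i ∘ low-injective)))
                      (afterSwapLow-fixes i′ i′≢p)

    rankOf-high : ∀ {j′} → j′ ≢ j → suc p < rankOf (high j′)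
    rankOf-high {j′} j′≢j with j′ Fin.≟ zero
    ... | yes refl = subst (suc p <_) (cong toℕ (sym moves)) (toℕ-high> j (j′≢j ∘ sym))
      where
        moves : rank ⟨$⟩ʳ firstHigh ≡ high j
        moves = trans (cong afterSwapLow (transpose-fix lastLow (low i) firstHigh high≢low high≢low))
                (trans (cong (swapMiddle ⟨$⟩ʳ_) (transpose-at₁ firstHigh (high j)))
                       (transpose-fix lastLow firstHigh (high j) high≢low ((j′≢j ∘ sym) ∘ high-injective)))
    ... | no j′≢0 = subst (suc p <_) (cong toℕ (sym moves)) (toℕ-high> j′ j′≢0)
      where
        moves : rank ⟨$⟩ʳ high j′ ≡ high j′
        moves = trans (cong afterSwapLow (transpose-fix lastLow (low i) (high j′) high≢low high≢low))
                (trans (cong (swapMiddle ⟨$⟩ʳ_)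
                         (transpose-fix firstHigh (high j) (high j′)
                                        (j′≢0 ∘ high-injective) (j′≢j ∘ high-injective)))
                       (transpose-fix lastLow firstHigh (high j′) high≢low (j′≢0 ∘ high-injective)))

    rankOf-low≤ : ∀ i′ → rankOf (low i′) ≤ suc p
    rankOf-low≤ i′ with i′ Fin.≟ i
    ... | yes refl = ℕ.≤-reflexive rankOf-low-pivot
    ... | no i′≢i = ℕ.m≤n⇒m≤1+n (ℕ.<⇒≤ (rankOf-low i′≢i))

    crossed-covers-pivots : Covers crossed (high j) (low i)
    crossed-covers-pivots =
      byRank-covers⁺ rank (subst₂ _<_ (sym rankOf-high-pivot) (sym rankOf-low-pivot) (ℕ.n<1+n p))

    crossed-covers-low : ∀ {i′} → i′ ≢ i → Covers crossed (low i′) (low i)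
    crossed-covers-low {i′} i′≢i =
      byRank-covers⁺ rank
        (subst (rankOf (low i′) <_) (sym rankOf-low-pivot) (ℕ.m<n⇒m<1+n (rankOf-low i′≢i)))

    crossed-covers-high : ∀ {j′} → j′ ≢ j → Covers crossed (high j) (high j′)
    crossed-covers-high {j′} j′≢j =
      byRank-covers⁺ rank
        (subst (_< rankOf (high j′)) (sym rankOf-high-pivot) (ℕ.<-trans (ℕ.n<1+n p) (rankOf-high j′≢j)))

    crossed-covers-high-low⇒pivots : ∀ {i′ j′} → Covers crossed (high j′) (low i′) → i′ ≡ i × j′ ≡ j
    crossed-covers-high-low⇒pivots {i′} {j′} c with lt ← byRank-covers⁻ rank c | i′ Fin.≟ i | j′ Fin.≟ j
    ... | yes refl | yes refl = refl , refl
    ... | _ | no j′≢j =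
      ⊥-elim (ℕ.<-irrefl refl (ℕ.<-≤-trans (ℕ.<-trans (rankOf-high j′≢j) lt) (rankOf-low≤ i′)))
    ... | no i′≢i | yes refl =
      ⊥-elim (ℕ.<-irrefl refl (subst (_< p) rankOf-high-pivot (ℕ.<-trans lt (rankOf-low i′≢i))))

  pivotPairs : List (Fin (suc p) × Fin (suc q))
  pivotPairs = cartesianProduct (allFin (suc p)) (allFin (suc q))

  crossings : List (Vec Point (suc p + suc q))
  crossings = map (uncurry crossed) pivotPairs

  crossed∈crossings : ∀ i j → crossed i j ∈ crossings
  crossed∈crossings i j = ∈-map⁺ (uncurry crossed) (∈-cartesianProduct⁺ (∈-allFin i) (∈-allFin j))

  crossed-injective : ∀ {ij i′j′} → uncurry crossed ij ≡ uncurry crossed i′j′ → ij ≡ i′j′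
  crossed-injective {i , j} {i′ , j′} e
    with refl , refl ← crossed-covers-high-low⇒pivots i′ j′
                         (subst (λ σ → Covers σ (high j) (low i)) e (crossed-covers-pivots i j)) =
    refl

  crossings-isPermSet : IsPermSet crossings
  crossings-isPermSet =
    All.map⁺ (All.universal (λ (i , j) → byRank-isPerm (rank i j)) _) ,
    Unique.map⁺ crossed-injective
      (Unique.cartesianProduct⁺ (Unique.allFin⁺ (suc p)) (Unique.allFin⁺ (suc q)))

  length-crossings : length crossings ≡ suc p * suc q
  length-crossings = begin
    length crossings                                   ≡⟨ length-map (uncurry crossed) pivotPairs ⟩
    length pivotPairs                                  ≡⟨ length-cartesianProduct (allFin (suc p)) (allFin (suc q)) ⟩
    length (allFin (suc p)) * length (allFin (suc q))  ≡⟨ cong₂ _*_ (length-tabulate {n = suc p} id)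
                                                                      (length-tabulate {n = suc q} id) ⟩
    suc p * suc q                                      ∎
    where open ≡-Reasoning

  crossings-inversionComplete : InversionComplete crossings
  crossings-inversionComplete k l k<l with lowOrHigh k | lowOrHigh l
  ... | isLow i | isLow i′ =
    crossed i zero , crossed∈crossings i zero ,
    crossed-covers-low i zero (λ { refl → Fin.<-irrefl refl k<l })
  ... | isLow i | isHigh j = crossed i j , crossed∈crossings i j , crossed-covers-pivots i j
  ... | isHigh j | isHigh j′ =
    crossed zero j′ , crossed∈crossings zero j′ ,
    crossed-covers-high zero j′ (λ { refl → Fin.<-irrefl refl k<l })
  ... | isHigh j | isLow i = ⊥-elim (Fin.<-asym k<l (low<high i j))

  crossings-minimal : ∀ Q′ → Q′ ⊂ crossings → ¬ InversionComplete Q′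
  crossings-minimal Q′ (Q′⊆ , σ , σ∈ , σ∉Q′) Q′-complete
    with (i , j) , _ , refl ← ∈-map⁻ (uncurry crossed) σ∈
    with ρ , ρ∈Q′ , ρ-covers ← Q′-complete (low i) (high j) (low<high i j)
    with (i′ , j′) , _ , refl ← ∈-map⁻ (uncurry crossed) (Q′⊆ ρ∈Q′)
    with refl , refl ← crossed-covers-high-low⇒pivots i′ j′ ρ-covers =
    σ∉Q′ ρ∈Q′

minInversionComplete-of-size : ∀ p q →
  ∃[ Q ] (IsPermSet {suc p + suc q} Q × MinInversionComplete Q × length Q ≡ suc p * suc q)
minInversionComplete-of-size p q =
  crossings , crossings-isPermSet , (crossings-inversionComplete , crossings-minimal) , length-crossings
  where open Crossed p q

quarterSquare≤length-maxMin : ∀ {n} → 2 ≤ n → (Q : List (Vec (Fin n) n)) →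
                              MaxMinInversionComplete Q → quarterSquare n ≤ length Q
quarterSquare≤length-maxMin {suc (suc m)} (s≤s (s≤s _)) Q (_ , _ , Q-maximum) =
  competitor (subst Family split family)
  where
    Family : ℕ → Set
    Family k = ∃[ Q′ ] (IsPermSet {k} Q′ × MinInversionComplete Q′ ×
                        length Q′ ≡ suc ⌊ m /2⌋ * suc ⌈ m /2⌉)

    family : Family (suc ⌊ m /2⌋ + suc ⌈ m /2⌉)
    family = minInversionComplete-of-size ⌊ m /2⌋ ⌈ m /2⌉

    split : suc ⌊ m /2⌋ + suc ⌈ m /2⌉ ≡ 2 + m
    split = cong suc (trans (ℕ.+-suc ⌊ m /2⌋ ⌈ m /2⌉) (cong suc (ℕ.⌊n/2⌋+⌈n/2⌉≡n m)))

    competitor : Family (2 + m) → quarterSquare (2 + m) ≤ length Q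
    competitor (Q′ , Q′-permSet , Q′-minIC , Q′-size) =
      subst (_≤ length Q) Q′-size (Q-maximum Q′ Q′-permSet Q′-minIC)

large-minimal⇒pairComplete : ∀ {n} (Q : List (Vec (Fin n) n)) → IsPermSet Q → MinInversionComplete Q →
                             4 ≤ n → quarterSquare n ≤ length Q → PairComplete Q
large-minimal⇒pairComplete {n} Q (Q-perm , Q-unique) Q-minIC 4≤n large a b a≢b with Fin.<-cmp a b
... | tri> _ _ b<a = proj₁ Q-minIC b a b<a
... | tri≈ _ a≡b _ = ⊥-elim (a≢b a≡b)
... | tri< a<b _ _ with Any.any? (λ σ → Covers? σ a b) Q
...   | yes covered = find covered
...   | no uncovered =
  ⊥-elim (ℕ.<⇒≱ (reversed-pair-bound Q-minIC 2<|Q| a<b reversed) large)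
  where
    open Counting Q Q-perm Q-unique
    2<|Q| : 2 < length Q
    2<|Q| = ℕ.≤-trans (ℕ.n≤1+n 3) (ℕ.≤-trans (quarterSquare-mono 4≤n) large)
    reversed : ∀ {ρ} → ρ ∈ Q → Covers ρ b a
    reversed {ρ} ρ∈Q with covers-total ρ (All.lookup Q-perm ρ∈Q) a≢b
    ... | inj₁ ρ-covers = ⊥-elim (uncovered (lose ρ∈Q ρ-covers))
    ... | inj₂ ρ-covers = ρ-covers

lemma8 : (n : ℕ) → 4 ≤ n → (τ : Vec (Fin n) n) → IsPerm τ →
         (Q : List (Vec (Fin n) n)) → MaxMinInversionComplete Q →
         MinPairComplete (τ ∘ₛ Q)
lemma8 n 4≤n τ τ-perm Q Q-maxMin@(Q-permSet , Q-minIC , _) =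
  ∘ₛ-pairComplete τ τ-perm (large-minimal⇒pairComplete Q Q-permSet Q-minIC 4≤n Q-large) ,
  ∘ₛ-minimal τ τ-perm Q-minIC
  where
    Q-large : quarterSquare n ≤ length Q
    Q-large = quarterSquare≤length-maxMin (ℕ.≤-trans (s≤s (s≤s z≤n)) 4≤n) Q Q-maxMin
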